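{- Let $x_1,\ldots,x_m,y_1,\ldots,y_n$ be elements of a nilpotent group $\Gamma$, with $m,n\ge1$. Then there is a finite list $\eta_1,\ldots,\eta_r$ of formal commutators in the letters $x_i$ and $y_j$ satisfying the following properties. (i) In $\Gamma$, $[x_1\cdots x_m,y_1\cdots y_n]=\eta_1\cdots\eta_r$. (ii) For each pair $x_i,y_{i'}$ there is some $\eta_j$ equal to $[x_i,y_{i'}]$. (iii) Every $\eta_j$ has at least one $x_i$ and at least one $y_{i'}$ amongst its arguments. (iv) The $\eta_j$ are all distinct as formal commutators in the $x_i,y_{i'}$. (v) No $\eta_j$ has a component of the form $[x_i,x_{i'}]$ or $[y_i,y_{i'}]$. (vi) If $\eta_j$ is not of the form $[x_i,y_{i'}]$ then $\eta_j$ has total weight greater than $2$.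
   Context: Formal commutators in letters: each letter is one, and $[\alpha,\alpha']$ is one whenever $\alpha,\alpha'$ are; they are interpreted in a group by substituting the group elements for the letters and using $[u,v]=u^{ -1}v^{ -1}uv$. The total weight is the number of letter occurrences. The components $C(\alpha)$ are defined by $C(x)=\{x\}$ for a letter and $C([\alpha,\alpha'])=C(\alpha)\cup C(\alpha')\cup\{[\alpha,\alpha']\}$; the arguments of $\alpha$ are the letters occurring in it. The $x_i$ and $y_j$ are treated as distinct letters. -}

module Defs where

open import Level using (Level)
open import Data.Nat using (ℕ; zero; suc; _+_; _<_; _≤_)
open import Data.Fin using (Fin)
open import Data.Sum using (_⊎_; inj₁; inj₂)
open import Data.Product using (Σ; ∃; ∃-syntax; _×_; _,_)
open import Data.List using (List; []; _∷_; map; foldr)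
open import Data.List.Relation.Unary.Any using (Any)
open import Data.List.Relation.Unary.All using (All)
open import Data.List.Relation.Unary.Unique.Propositional using (Unique)
open import Data.Vec using (Vec; toList)
open import Relation.Binary.PropositionalEquality using (_≡_)
open import Relation.Nullary using (¬_)
open import Algebra.Bundles using (Group)

data Comm (A : Set) : Set where
  letter : A → Comm A
  com    : Comm A → Comm A → Comm A

module _ {A : Set} where

  weight : Comm A → ℕ
  weight (letter _) = 1
  weight (com α β) = weight α + weight β

  data Occurs (a : A) : Comm A → Set where
    here  : Occurs a (letter a)
    left  : ∀ {α β} → Occurs a α → Occurs a (com α β)
    right : ∀ {α β} → Occurs a β → Occurs a (com α β)

  data Component : Comm A → Comm A → Set where
    self  : ∀ {α} → Component α α
    left  : ∀ {γ α β} → Component γ α → Component γ (com α β)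
    right : ∀ {γ α β} → Component γ β → Component γ (com α β)

module _ {c ℓ : Level} (G : Group c ℓ) where
  open Group G

  ⟦_,_⟧ : Carrier → Carrier → Carrier
  ⟦ u , v ⟧ = ((u ⁻¹ ∙ v ⁻¹) ∙ u) ∙ v

  eval : {A : Set} → (A → Carrier) → Comm A → Carrier
  eval f (letter a) = f a
  eval f (com α β) = ⟦ eval f α , eval f β ⟧

  prod : List Carrier → Carrier
  prod = foldr _∙_ ε

  prodFin : (m : ℕ) → (Fin m → Carrier) → Carrier
  prodFin m x = prod (Data.List.tabulate x)

  leftNormed : Carrier → List Carrier → Carrier
  leftNormed g [] = g
  leftNormed g (h ∷ hs) = leftNormed ⟦ g , h ⟧ hs

  -- nilpotent (of some class k): all left-normed commutators of
  -- weight k+1 are trivial, i.e. γ_{k+1}(G) = 1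
  IsNilpotent : Set (c Level.⊔ ℓ)
  IsNilpotent = ∃[ k ] ∀ (g : Carrier) (hs : Vec Carrier k) → leftNormed g (toList hs) ≈ ε

Letter : ℕ → ℕ → Set
Letter m n = Fin m ⊎ Fin n

xl : ∀ {m n} → Fin m → Comm (Letter m n)
xl i = letter (inj₁ i)

yl : ∀ {m n} → Fin n → Comm (Letter m n)
yl j = letter (inj₂ j)

subst-xy : ∀ {a} {C : Set a} {m n} → (Fin m → C) → (Fin n → C) → Letter m n → C
subst-xy x y (inj₁ i) = x i
subst-xy x y (inj₂ j) = y j

module Submission where

-- The list is built from three group identities (conjugation written u^g = g⁻¹ u g):
--   u^b = u · [u,b],      [a , b·C] = [a,C] · [a,b]^C,      [a·X , Y] = [a,Y]^X · [X,Y].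
-- Reading a product of formal commutators as a list, the first identity turns U^b into the
-- list in which every u is followed by [u,b]; iterating it gives U^(b₁⋯bₖ).  The second gives
-- a list for [a, b₁⋯bₖ] and the third one for [a₁⋯aₗ , b₁⋯bₖ].  Every entry of the resulting
-- list is a left-normed commutator [[a,b],c₁,…,cₖ] with a among the aᵢ and b among the bⱼ;
-- properties (iii), (v), (vi) of the theorem are consequences of this shape alone.  The
-- entries are distinct because the letters appended by conjugation are never repeated.
--
-- The argument works in every
-- group.

open import Defs
open import Level using (Level)
open import Data.Nat using (ℕ; suc; _≤_; _<_; z≤n; s≤s)
open import Data.Nat.Properties using (≤-trans; m≤m+n; +-monoˡ-≤)
open import Data.Fin using (Fin; _≟_) renaming (zero to #0; suc to #suc)
open import Data.Bool using (Bool; true; false)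
open import Data.Sum using (_⊎_; inj₁; inj₂)
open import Data.Sum.Properties using (inj₁-injective; inj₂-injective)
open import Data.Product using (Σ; ∃; ∃-syntax; ∃₂; _×_; _,_; proj₁; proj₂)
open import Data.List using (List; []; _∷_; _++_; map; tabulate)
open import Data.List.Properties using (map-tabulate)
open import Data.List.Relation.Unary.Any using (Any; here; there)
import Data.List.Relation.Unary.Any as Any
open import Data.List.Relation.Unary.All using (All; []; _∷_)
open import Data.List.Relation.Unary.AllPairs using ([]; _∷_)
import Data.List.Relation.Unary.All as All
import Data.List.Relation.Unary.All.Properties as All
open import Data.List.Relation.Unary.Unique.Propositional using (Unique)
import Data.List.Relation.Unary.Unique.Propositional.Properties as Unique
open import Data.List.Membership.Propositional using (_∈_)
open import Data.List.Membership.Propositional.Properties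
  using (∈-++⁺ˡ; ∈-++⁺ʳ; ∈-tabulate⁻; ∈-tabulate⁺)
open import Data.Vec using (Vec; lookup) renaming ([] to ⟨⟩; _∷_ to _,,_)
open import Data.Empty using (⊥; ⊥-elim)
open import Relation.Binary.PropositionalEquality as ≡ using (_≡_; _≢_; cong)
open import Relation.Nullary using (¬_; yes; no)
open import Algebra.Bundles using (Group)

-- Group expressions in k variables, and reduced words in the free group on k generators,
-- represented as lists of signed generators (true = the generator, false = its inverse).
data GroupExpr (k : ℕ) : Set where
  var  : Fin k → GroupExpr k
  unit : GroupExpr k
  _⊕_  : GroupExpr k → GroupExpr k → GroupExpr k
  inv  : GroupExpr k → GroupExpr k

SignedGen : ℕ → Set
SignedGen k = Fin k × Bool

push : ∀ {k} → SignedGen k → List (SignedGen k) → List (SignedGen k)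
push g [] = g ∷ []
push (i , s) ((j , t) ∷ w) with i ≟ j
push (i , true)  ((j , false) ∷ w) | yes _ = w
push (i , false) ((j , true)  ∷ w) | yes _ = w
push (i , true)  ((j , true)  ∷ w) | yes _ = (i , true) ∷ (j , true) ∷ w
push (i , false) ((j , false) ∷ w) | yes _ = (i , false) ∷ (j , false) ∷ w
... | no _ = (i , s) ∷ (j , t) ∷ w

append : ∀ {k} → List (SignedGen k) → List (SignedGen k) → List (SignedGen k)
append []      w = w
append (g ∷ u) w = push g (append u w)

invertGen : ∀ {k} → SignedGen k → SignedGen k
invertGen (i , true)  = i , false
invertGen (i , false) = i , true

invertWord : ∀ {k} → List (SignedGen k) → List (SignedGen k)
invertWord []      = []
invertWord (g ∷ u) = append (invertWord u) (invertGen g ∷ [])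

normalForm : ∀ {k} → GroupExpr k → List (SignedGen k)
normalForm (var i) = (i , true) ∷ []
normalForm unit    = []
normalForm (a ⊕ b) = append (normalForm a) (normalForm b)
normalForm (inv a) = invertWord (normalForm a)

module WordSolver {c ℓ : Level} (G : Group c ℓ) where
  open Group G
  open import Algebra.Properties.Group G using (ε⁻¹≈ε; ⁻¹-involutive; ⁻¹-anti-homo-∙)
  open import Relation.Binary.Reasoning.Setoid setoid

  module _ {k} (ρ : Vec Carrier k) where
    ⟦_⟧ : GroupExpr k → Carrier
    ⟦ var i ⟧ = lookup ρ i
    ⟦ unit ⟧  = ε
    ⟦ a ⊕ b ⟧ = ⟦ a ⟧ ∙ ⟦ b ⟧
    ⟦ inv a ⟧ = ⟦ a ⟧ ⁻¹

    ⟦_⟧ᵍ : SignedGen k → Carrier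
    ⟦ i , true ⟧ᵍ  = lookup ρ i
    ⟦ i , false ⟧ᵍ = lookup ρ i ⁻¹

    ⟦_⟧ʷ : List (SignedGen k) → Carrier
    ⟦ [] ⟧ʷ    = ε
    ⟦ g ∷ w ⟧ʷ = ⟦ g ⟧ᵍ ∙ ⟦ w ⟧ʷ

    cancel-⁻¹ʳ : ∀ u v → v ≈ u ∙ (u ⁻¹ ∙ v)
    cancel-⁻¹ʳ u v = sym (begin
      u ∙ (u ⁻¹ ∙ v) ≈⟨ assoc _ _ _ ⟨
      (u ∙ u ⁻¹) ∙ v ≈⟨ ∙-congʳ (inverseʳ u) ⟩
      ε ∙ v          ≈⟨ identityˡ v ⟩
      v              ∎)

    cancel-⁻¹ˡ : ∀ u v → v ≈ u ⁻¹ ∙ (u ∙ v)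
    cancel-⁻¹ˡ u v = sym (begin
      u ⁻¹ ∙ (u ∙ v) ≈⟨ assoc _ _ _ ⟨
      (u ⁻¹ ∙ u) ∙ v ≈⟨ ∙-congʳ (inverseˡ u) ⟩
      ε ∙ v          ≈⟨ identityˡ v ⟩
      v              ∎)

    push-sound : ∀ g w → ⟦ push g w ⟧ʷ ≈ ⟦ g ⟧ᵍ ∙ ⟦ w ⟧ʷ
    push-sound g [] = refl
    push-sound (i , s) ((j , t) ∷ w) with i ≟ j
    push-sound (i , true)  ((j , false) ∷ w) | yes ≡.refl = cancel-⁻¹ʳ _ _
    push-sound (i , false) ((j , true)  ∷ w) | yes ≡.refl = cancel-⁻¹ˡ _ _
    push-sound (i , true)  ((j , true)  ∷ w) | yes _ = refl
    push-sound (i , false) ((j , false) ∷ w) | yes _ = refl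
    ... | no _ = refl

    append-sound : ∀ u w → ⟦ append u w ⟧ʷ ≈ ⟦ u ⟧ʷ ∙ ⟦ w ⟧ʷ
    append-sound []      w = sym (identityˡ _)
    append-sound (g ∷ u) w = begin
      ⟦ push g (append u w) ⟧ʷ  ≈⟨ push-sound g (append u w) ⟩
      ⟦ g ⟧ᵍ ∙ ⟦ append u w ⟧ʷ  ≈⟨ ∙-congˡ (append-sound u w) ⟩
      ⟦ g ⟧ᵍ ∙ (⟦ u ⟧ʷ ∙ ⟦ w ⟧ʷ) ≈⟨ assoc _ _ _ ⟨
      (⟦ g ⟧ᵍ ∙ ⟦ u ⟧ʷ) ∙ ⟦ w ⟧ʷ ∎

    invertGen-sound : ∀ g → ⟦ invertGen g ⟧ᵍ ≈ ⟦ g ⟧ᵍ ⁻¹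
    invertGen-sound (i , true)  = refl
    invertGen-sound (i , false) = sym (⁻¹-involutive _)

    invertWord-sound : ∀ u → ⟦ invertWord u ⟧ʷ ≈ ⟦ u ⟧ʷ ⁻¹
    invertWord-sound []      = sym ε⁻¹≈ε
    invertWord-sound (g ∷ u) = begin
      ⟦ append (invertWord u) (invertGen g ∷ []) ⟧ʷ ≈⟨ append-sound (invertWord u) _ ⟩
      ⟦ invertWord u ⟧ʷ ∙ (⟦ invertGen g ⟧ᵍ ∙ ε)    ≈⟨ ∙-cong (invertWord-sound u) (identityʳ _) ⟩
      ⟦ u ⟧ʷ ⁻¹ ∙ ⟦ invertGen g ⟧ᵍ                  ≈⟨ ∙-congˡ (invertGen-sound g) ⟩
      ⟦ u ⟧ʷ ⁻¹ ∙ ⟦ g ⟧ᵍ ⁻¹                         ≈⟨ ⁻¹-anti-homo-∙ _ _ ⟨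
      (⟦ g ⟧ᵍ ∙ ⟦ u ⟧ʷ) ⁻¹                          ∎

    normalForm-sound : ∀ a → ⟦ normalForm a ⟧ʷ ≈ ⟦ a ⟧
    normalForm-sound (var i) = identityʳ _
    normalForm-sound unit    = refl
    normalForm-sound (a ⊕ b) =
      trans (append-sound (normalForm a) (normalForm b)) (∙-cong (normalForm-sound a) (normalForm-sound b))
    normalForm-sound (inv a) = trans (invertWord-sound (normalForm a)) (⁻¹-cong (normalForm-sound a))

    solve : ∀ a b → normalForm a ≡ normalForm b → ⟦ a ⟧ ≈ ⟦ b ⟧
    solve a b same = begin
      ⟦ a ⟧              ≈⟨ normalForm-sound a ⟨
      ⟦ normalForm a ⟧ʷ  ≡⟨ cong ⟦_⟧ʷ same ⟩
      ⟦ normalForm b ⟧ʷ  ≈⟨ normalForm-sound b ⟩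
      ⟦ b ⟧              ∎

module CommutatorIdentities {c ℓ : Level} (G : Group c ℓ) where
  open Group G
  open WordSolver G using (solve)

  [_,_] : Carrier → Carrier → Carrier
  [ u , v ] = ⟦_,_⟧ G u v

  _^_ : Carrier → Carrier → Carrier
  u ^ g = (g ⁻¹ ∙ u) ∙ g

  private
    ⟪_,_⟫ ⟪_^_⟫ : ∀ {k} → GroupExpr k → GroupExpr k → GroupExpr k
    ⟪ a , b ⟫ = ((inv a ⊕ inv b) ⊕ a) ⊕ b
    ⟪ a ^ b ⟫ = (inv b ⊕ a) ⊕ b

    x₀ : ∀ {k} → GroupExpr (suc k)
    x₀ = var #0
    x₁ : ∀ {k} → GroupExpr (suc (suc k))
    x₁ = var (#suc #0)
    x₂ : ∀ {k} → GroupExpr (suc (suc (suc k)))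
    x₂ = var (#suc (#suc #0))

  comm-cong : ∀ {u u′ v v′} → u ≈ u′ → v ≈ v′ → [ u , v ] ≈ [ u′ , v′ ]
  comm-cong p q = ∙-cong (∙-cong (∙-cong (⁻¹-cong p) (⁻¹-cong q)) p) q

  ^-congˡ : ∀ {u u′ g} → u ≈ u′ → u ^ g ≈ u′ ^ g
  ^-congˡ p = ∙-congʳ (∙-congˡ p)

  ∙-comm≈^ : ∀ u g → u ∙ [ u , g ] ≈ u ^ g
  ∙-comm≈^ u g = solve (u ,, g ,, ⟨⟩) (x₀ ⊕ ⟪ x₀ , x₁ ⟫) ⟪ x₀ ^ x₁ ⟫ ≡.refl

  ε^ : ∀ g → ε ≈ ε ^ g
  ε^ g = solve (g ,, ⟨⟩) unit ⟪ unit ^ x₀ ⟫ ≡.refl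

  ^-∙ : ∀ u v g → (u ^ g) ∙ (v ^ g) ≈ (u ∙ v) ^ g
  ^-∙ u v g = solve (u ,, v ,, g ,, ⟨⟩) (⟪ x₀ ^ x₂ ⟫ ⊕ ⟪ x₁ ^ x₂ ⟫) ⟪ (x₀ ⊕ x₁) ^ x₂ ⟫ ≡.refl

  ^ε : ∀ u → u ≈ u ^ ε
  ^ε u = solve (u ,, ⟨⟩) x₀ ⟪ x₀ ^ unit ⟫ ≡.refl

  ^-^ : ∀ u g h → (u ^ g) ^ h ≈ u ^ (g ∙ h)
  ^-^ u g h = solve (u ,, g ,, h ,, ⟨⟩) ⟪ ⟪ x₀ ^ x₁ ⟫ ^ x₂ ⟫ ⟪ x₀ ^ (x₁ ⊕ x₂) ⟫ ≡.refl

  comm-ε-right : ∀ a → ε ≈ [ a , ε ]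
  comm-ε-right a = solve (a ,, ⟨⟩) unit ⟪ x₀ , unit ⟫ ≡.refl

  comm-∙-right : ∀ a b C → [ a , C ] ∙ ([ a , b ] ^ C) ≈ [ a , b ∙ C ]
  comm-∙-right a b C = solve (a ,, b ,, C ,, ⟨⟩) (⟪ x₀ , x₂ ⟫ ⊕ ⟪ ⟪ x₀ , x₁ ⟫ ^ x₂ ⟫) ⟪ x₀ , x₁ ⊕ x₂ ⟫ ≡.refl

  comm-ε-left : ∀ Y → ε ≈ [ ε , Y ]
  comm-ε-left Y = solve (Y ,, ⟨⟩) unit ⟪ unit , x₀ ⟫ ≡.refl

  comm-∙-left : ∀ a X Y → ([ a , Y ] ^ X) ∙ [ X , Y ] ≈ [ a ∙ X , Y ]
  comm-∙-left a X Y = solve (a ,, X ,, Y ,, ⟨⟩) (⟪ ⟪ x₀ , x₂ ⟫ ^ x₁ ⟫ ⊕ ⟪ x₁ , x₂ ⟫) ⟪ x₀ ⊕ x₁ , x₂ ⟫ ≡.refl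

-- The lists of formal commutators.  A list U stands for the product of its entries.
module _ {A : Set} where

  -- U^b: every entry u is followed by [u,b], since u^b = u [u,b].
  conjByLetter : A → List (Comm A) → List (Comm A)
  conjByLetter b []      = []
  conjByLetter b (u ∷ U) = u ∷ com u (letter b) ∷ conjByLetter b U

  conjByWord : List A → List (Comm A) → List (Comm A)
  conjByWord []       U = U
  conjByWord (b ∷ bs) U = conjByWord bs (conjByLetter b U)

  -- [a , b·C] = [a,C] · [a,b]^C, with C = b₂⋯bₖ
  commLetterWord : A → List A → List (Comm A)
  commLetterWord a []       = []
  commLetterWord a (b ∷ bs) = commLetterWord a bs ++ conjByWord bs (com (letter a) (letter b) ∷ [])

  -- [a·X , Y] = [a,Y]^X · [X,Y], with X = a₂⋯aₗ
  commWords : List A → List A → List (Comm A)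
  commWords []       bs = []
  commWords (a ∷ as) bs = conjByWord as (commLetterWord a bs) ++ commWords as bs

module Evaluation {c ℓ : Level} (G : Group c ℓ) {A : Set} (f : A → Group.Carrier G) where
  open Group G
  open CommutatorIdentities G
  open import Relation.Binary.Reasoning.Setoid setoid

  value : List (Comm A) → Carrier
  value U = prod G (map (eval G f) U)

  word : List A → Carrier
  word bs = prod G (map f bs)

  value-++ : ∀ U V → value (U ++ V) ≈ value U ∙ value V
  value-++ []      V = sym (identityˡ _)
  value-++ (u ∷ U) V = trans (∙-congˡ (value-++ U V)) (sym (assoc _ _ _))

  conjByLetter-value : ∀ b U → value (conjByLetter b U) ≈ value U ^ f b
  conjByLetter-value b []      = ε^ _
  conjByLetter-value b (u ∷ U) = begin
    eval G f u ∙ ([ eval G f u , f b ] ∙ value (conjByLetter b U)) ≈⟨ assoc _ _ _ ⟨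
    (eval G f u ∙ [ eval G f u , f b ]) ∙ value (conjByLetter b U) ≈⟨ ∙-cong (∙-comm≈^ _ _) (conjByLetter-value b U) ⟩
    (eval G f u ^ f b) ∙ (value U ^ f b)                          ≈⟨ ^-∙ _ _ _ ⟩
    value (u ∷ U) ^ f b                                           ∎

  conjByWord-value : ∀ bs U → value (conjByWord bs U) ≈ value U ^ word bs
  conjByWord-value []       U = ^ε _
  conjByWord-value (b ∷ bs) U = begin
    value (conjByWord bs (conjByLetter b U)) ≈⟨ conjByWord-value bs (conjByLetter b U) ⟩
    value (conjByLetter b U) ^ word bs       ≈⟨ ^-congˡ (conjByLetter-value b U) ⟩
    (value U ^ f b) ^ word bs                ≈⟨ ^-^ _ _ _ ⟩
    value U ^ word (b ∷ bs)                  ∎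

  commLetterWord-value : ∀ a bs → value (commLetterWord a bs) ≈ [ f a , word bs ]
  commLetterWord-value a []       = comm-ε-right _
  commLetterWord-value a (b ∷ bs) = begin
    value (commLetterWord a bs ++ conjByWord bs ab)           ≈⟨ value-++ (commLetterWord a bs) _ ⟩
    value (commLetterWord a bs) ∙ value (conjByWord bs ab)    ≈⟨ ∙-cong (commLetterWord-value a bs) (conjByWord-value bs ab) ⟩
    [ f a , word bs ] ∙ (([ f a , f b ] ∙ ε) ^ word bs)       ≈⟨ ∙-congˡ (^-congˡ (identityʳ _)) ⟩
    [ f a , word bs ] ∙ ([ f a , f b ] ^ word bs)             ≈⟨ comm-∙-right _ _ _ ⟩
    [ f a , word (b ∷ bs) ]                                   ∎
    where
    ab : List (Comm A)
    ab = com (letter a) (letter b) ∷ []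

  commWords-value : ∀ as bs → value (commWords as bs) ≈ [ word as , word bs ]
  commWords-value []       bs = comm-ε-left _
  commWords-value (a ∷ as) bs = begin
    value (conjByWord as (commLetterWord a bs) ++ commWords as bs)        ≈⟨ value-++ (conjByWord as _) _ ⟩
    value (conjByWord as (commLetterWord a bs)) ∙ value (commWords as bs) ≈⟨ ∙-cong (conjByWord-value as _) (commWords-value as bs) ⟩
    (value (commLetterWord a bs) ^ word as) ∙ [ word as , word bs ]       ≈⟨ ∙-congʳ (^-congˡ (commLetterWord-value a bs)) ⟩
    ([ f a , word bs ] ^ word as) ∙ [ word as , word bs ]                 ≈⟨ comm-∙-left _ _ _ ⟩
    [ word (a ∷ as) , word bs ]                                           ∎

module _ {A : Set} where

  data LeftNormed (a b : A) : Comm A → Set where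
    base : LeftNormed a b (com (letter a) (letter b))
    step : ∀ {u c} → LeftNormed a b u → LeftNormed a b (com u (letter c))

  ¬LeftNormed-letter : ∀ {a b l} → ¬ LeftNormed a b (letter l)
  ¬LeftNormed-letter ()

  LeftNormed-unique : ∀ {a b a′ b′ w} → LeftNormed a b w → LeftNormed a′ b′ w → a ≡ a′ × b ≡ b′
  LeftNormed-unique base     base     = ≡.refl , ≡.refl
  LeftNormed-unique base     (step s) = ⊥-elim (¬LeftNormed-letter s)
  LeftNormed-unique (step s) base     = ⊥-elim (¬LeftNormed-letter s)
  LeftNormed-unique (step s) (step t) = LeftNormed-unique s t

  LeftNormed-occurs : ∀ {a b w} → LeftNormed a b w → Occurs a w × Occurs b w
  LeftNormed-occurs base     = left here , right here
  LeftNormed-occurs (step s) = left (proj₁ (LeftNormed-occurs s)) , left (proj₂ (LeftNormed-occurs s))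

  LeftNormed-pair : ∀ {a b c d} → LeftNormed a b (com (letter c) (letter d)) → c ≡ a × d ≡ b
  LeftNormed-pair base     = ≡.refl , ≡.refl
  LeftNormed-pair (step s) = ⊥-elim (¬LeftNormed-letter s)

  component-of-letter : ∀ {γ : Comm A} {l : A} → Component γ (letter l) → γ ≡ letter l
  component-of-letter self = ≡.refl

  LeftNormed-component : ∀ {a b γ w} → Component γ w → LeftNormed a b w →
                         LeftNormed a b γ ⊎ ∃ λ l → γ ≡ letter l
  LeftNormed-component self      s        = inj₁ s
  LeftNormed-component (left p)  base     = inj₂ (_ , component-of-letter p)
  LeftNormed-component (right p) base     = inj₂ (_ , component-of-letter p)
  LeftNormed-component (left p)  (step s) = LeftNormed-component p s
  LeftNormed-component (right p) (step s) = inj₂ (_ , component-of-letter p)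

  LeftNormed-weight≥2 : ∀ {a b w} → LeftNormed a b w → 2 ≤ weight w
  LeftNormed-weight≥2 base     = s≤s (s≤s z≤n)
  LeftNormed-weight≥2 (step s) = ≤-trans (LeftNormed-weight≥2 s) (m≤m+n _ 1)

  LeftNormed-weight : ∀ {a b w} → LeftNormed a b w → w ≡ com (letter a) (letter b) ⊎ 2 < weight w
  LeftNormed-weight base     = inj₁ ≡.refl
  LeftNormed-weight (step s) = inj₂ (+-monoˡ-≤ 1 (LeftNormed-weight≥2 s))

  conjByWord-preserves : ∀ {p} {P : Comm A → Set p} bs U →
    (∀ {u c} → c ∈ bs → P u → P (com u (letter c))) → All P U → All P (conjByWord bs U)
  conjByWord-preserves []       U stable PU = PU
  conjByWord-preserves (b ∷ bs) U stable PU =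
    conjByWord-preserves bs (conjByLetter b U) (λ c∈bs → stable (there c∈bs)) (conjByLetter-preserves U PU)
    where
    conjByLetter-preserves : ∀ U → All _ U → All _ (conjByLetter b U)
    conjByLetter-preserves []      []         = []
    conjByLetter-preserves (u ∷ U) (Pu ∷ PU) = Pu ∷ stable (here ≡.refl) Pu ∷ conjByLetter-preserves U PU

  commLetterWord-shape : ∀ a bs → All (λ w → ∃ λ b → b ∈ bs × LeftNormed a b w) (commLetterWord a bs)
  commLetterWord-shape a []       = []
  commLetterWord-shape a (b ∷ bs) = All.++⁺
    (All.map (λ { (b′ , b′∈ , s) → b′ , there b′∈ , s }) (commLetterWord-shape a bs))
    (conjByWord-preserves bs _ (λ { _ (b′ , b′∈ , s) → b′ , b′∈ , step s }) ((b , here ≡.refl , base) ∷ []))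

  commWords-shape : ∀ as bs → All (λ w → ∃₂ λ a b → a ∈ as × b ∈ bs × LeftNormed a b w) (commWords as bs)
  commWords-shape []       bs = []
  commWords-shape (a ∷ as) bs = All.++⁺
    (conjByWord-preserves as _ (λ { _ (a′ , b′ , a′∈ , b′∈ , s) → a′ , b′ , a′∈ , b′∈ , step s })
      (All.map (λ { (b′ , b′∈ , s) → a , b′ , here ≡.refl , b′∈ , s }) (commLetterWord-shape a bs)))
    (All.map (λ { (a′ , b′ , a′∈ , b′∈ , s) → a′ , b′ , there a′∈ , b′∈ , s }) (commWords-shape as bs))

-- Distinctness of the entries.  Conjugation by b appends b to entries that do not already
-- end in b, and the letters of a word are appended in order, so no entry is produced twice.
module _ {A : Set} where

  -- The last letter appended to a commutator (a letter is its own right argument).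
  rightArg : Comm A → Comm A
  rightArg (letter a) = letter a
  rightArg (com u v)  = v

  letter-injective : ∀ {a b : A} → letter a ≡ letter b → a ≡ b
  letter-injective ≡.refl = ≡.refl

  conjByLetter-∈⁻ : ∀ {b w} U → w ∈ conjByLetter b U → w ∈ U ⊎ ∃ λ (u : Comm A) → u ∈ U × w ≡ com u (letter b)
  conjByLetter-∈⁻ (u ∷ U) (here w≡u)         = inj₁ (here w≡u)
  conjByLetter-∈⁻ (u ∷ U) (there (here w≡ub)) = inj₂ (u , here ≡.refl , w≡ub)
  conjByLetter-∈⁻ (u ∷ U) (there (there w∈))  with conjByLetter-∈⁻ U w∈
  ... | inj₁ w∈U              = inj₁ (there w∈U)
  ... | inj₂ (u′ , u′∈U , w≡) = inj₂ (u′ , there u′∈U , w≡)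

  conjByLetter-unique : ∀ {b} U → Unique U → All (λ u → rightArg u ≢ letter b) U →
                        Unique (conjByLetter b U)
  conjByLetter-unique []                                    _                  _          = []
  conjByLetter-unique {b} (u ∷ U) (u∉U ∷ uniqueU) (u≢ ∷ U≢) =
    All.tabulate u-fresh ∷ All.tabulate ub-fresh ∷ conjByLetter-unique U uniqueU U≢
    where
    u-fresh : ∀ {w} → w ∈ com u (letter b) ∷ conjByLetter b U → u ≢ w
    u-fresh (here ≡.refl) u≡ub = u≢ (cong rightArg u≡ub)
    u-fresh (there w∈) u≡w with conjByLetter-∈⁻ U w∈
    ... | inj₁ w∈U             = All.lookup u∉U w∈U u≡w
    ... | inj₂ (_ , _ , ≡.refl) = u≢ (cong rightArg u≡w)
    ub-fresh : ∀ {w} → w ∈ conjByLetter b U → com u (letter b) ≢ w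
    ub-fresh w∈ ub≡w with conjByLetter-∈⁻ U w∈
    ... | inj₁ w∈U = All.lookup U≢ w∈U (cong rightArg (≡.sym ub≡w))
    ub-fresh w∈ ≡.refl | inj₂ (u′ , u′∈U , ≡.refl) = All.lookup u∉U u′∈U ≡.refl

  conjByWord-unique : ∀ bs U → Unique bs → Unique U →
                      All (λ u → ∀ {c} → c ∈ bs → rightArg u ≢ letter c) U → Unique (conjByWord bs U)
  conjByWord-unique []       U _                 uniqueU _  = uniqueU
  conjByWord-unique (b ∷ bs) U (b∉bs ∷ uniquebs) uniqueU U≢ =
    conjByWord-unique bs (conjByLetter b U) uniquebs
      (conjByLetter-unique U uniqueU (All.map (λ u≢ → u≢ (here ≡.refl)) U≢))
      (All.tabulate fresh)
    where
    fresh : ∀ {w} → w ∈ conjByLetter b U → ∀ {c} → c ∈ bs → rightArg w ≢ letter c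
    fresh w∈ c∈bs w≡c with conjByLetter-∈⁻ U w∈
    ... | inj₁ w∈U = All.lookup U≢ w∈U (there c∈bs) w≡c
    fresh w∈ c∈bs b≡c | inj₂ (_ , _ , ≡.refl) = All.lookup b∉bs c∈bs (letter-injective b≡c)

  commLetterWord-rightArg : ∀ a bs → All (λ w → ∃ λ c → c ∈ bs × rightArg w ≡ letter c) (commLetterWord a bs)
  commLetterWord-rightArg a []       = []
  commLetterWord-rightArg a (b ∷ bs) = All.++⁺
    (All.map (λ { (c , c∈ , w≡c) → c , there c∈ , w≡c }) (commLetterWord-rightArg a bs))
    (conjByWord-preserves bs _ (λ { c∈ _ → _ , there c∈ , ≡.refl }) ((b , here ≡.refl , ≡.refl) ∷ []))

  commLetterWord-unique : ∀ a bs → Unique bs → Unique (commLetterWord a bs)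
  commLetterWord-unique a []       _                 = []
  commLetterWord-unique a (b ∷ bs) (b∉bs ∷ uniquebs) =
    Unique.++⁺ (commLetterWord-unique a bs uniquebs)
      (conjByWord-unique bs _ uniquebs ([] ∷ [])
        ((λ c∈bs b≡c → All.lookup b∉bs c∈bs (letter-injective b≡c)) ∷ []))
      disjoint
    where
    -- old entries start with [a,bⱼ] for some bⱼ ∈ bs, new ones with [a,b]
    disjoint : ∀ {w} → ¬ (w ∈ commLetterWord a bs × w ∈ conjByWord bs (com (letter a) (letter b) ∷ []))
    disjoint (w∈old , w∈new)
      with All.lookup (commLetterWord-shape a bs) w∈old
         | All.lookup (conjByWord-preserves {P = LeftNormed a b} bs _ (λ _ → step) (base ∷ [])) w∈new
    ... | (_ , b′∈bs , s) | t = All.lookup b∉bs b′∈bs (≡.sym (proj₂ (LeftNormed-unique s t)))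

  commWords-unique : ∀ as bs → Unique as → Unique bs → (∀ {c} → c ∈ as → c ∈ bs → ⊥) →
                     Unique (commWords as bs)
  commWords-unique []       bs _                 _        _        = []
  commWords-unique (a ∷ as) bs (a∉as ∷ uniqueas) uniquebs disjointLetters =
    Unique.++⁺
      (conjByWord-unique as _ uniqueas (commLetterWord-unique a bs uniquebs)
        (All.map (λ {w} ends {c} → ends-in-bs {w} ends {c}) (commLetterWord-rightArg a bs)))
      (commWords-unique as bs uniqueas uniquebs (λ c∈as → disjointLetters (there c∈as)))
      disjoint
    where
    ends-in-bs : ∀ {w} → (∃ λ c → c ∈ bs × rightArg w ≡ letter c) → ∀ {c} → c ∈ as → rightArg w ≢ letter c
    ends-in-bs (c′ , c′∈bs , w≡c′) c∈as w≡c =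
      disjointLetters (there c∈as) (≡.subst (_∈ bs) (letter-injective (≡.trans (≡.sym w≡c′) w≡c)) c′∈bs)
    -- new entries start with [a,bⱼ], later ones with [aᵢ,bⱼ] for aᵢ ∈ as
    disjoint : ∀ {w} → ¬ (w ∈ conjByWord as (commLetterWord a bs) × w ∈ commWords as bs)
    disjoint (w∈new , w∈old)
      with All.lookup (conjByWord-preserves {P = λ w → ∃ λ b′ → LeftNormed a b′ w} as _
                        (λ { _ (b′ , s) → b′ , step s })
                        (All.map (λ { (b′ , _ , s) → b′ , s }) (commLetterWord-shape a bs))) w∈new
         | All.lookup (commWords-shape as bs) w∈old
    ... | (_ , s) | (_ , _ , a′∈as , _ , t) = All.lookup a∉as a′∈as (proj₁ (LeftNormed-unique s t))

  conjByWord-⊇ : ∀ {w : Comm A} bs U → w ∈ U → w ∈ conjByWord bs U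
  conjByWord-⊇ []       U w∈ = w∈
  conjByWord-⊇ (b ∷ bs) U w∈ = conjByWord-⊇ bs (conjByLetter b U) (conjByLetter-⊇ U w∈)
    where
    conjByLetter-⊇ : ∀ {w} U → w ∈ U → w ∈ conjByLetter b U
    conjByLetter-⊇ (u ∷ U) (here w≡u) = here w≡u
    conjByLetter-⊇ (u ∷ U) (there w∈) = there (there (conjByLetter-⊇ U w∈))

  commLetterWord-∋ : ∀ a b bs → b ∈ bs → com (letter a) (letter b) ∈ commLetterWord a bs
  commLetterWord-∋ a b (b ∷ bs) (here ≡.refl) = ∈-++⁺ʳ (commLetterWord a bs) (conjByWord-⊇ bs _ (here ≡.refl))
  commLetterWord-∋ a b (_ ∷ bs) (there b∈)    = ∈-++⁺ˡ (commLetterWord-∋ a b bs b∈)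

  commWords-∋ : ∀ a b as bs → a ∈ as → b ∈ bs → com (letter a) (letter b) ∈ commWords as bs
  commWords-∋ a b (a ∷ as) bs (here ≡.refl) b∈ = ∈-++⁺ˡ (conjByWord-⊇ as _ (commLetterWord-∋ a b bs b∈))
  commWords-∋ a b (_ ∷ as) bs (there a∈)    b∈ = ∈-++⁺ʳ (conjByWord as _) (commWords-∋ a b as bs a∈ b∈)

module _ {m n : ℕ} where

  xLetters yLetters : List (Letter m n)
  xLetters = tabulate inj₁
  yLetters = tabulate inj₂

  xLetters-unique : Unique xLetters
  xLetters-unique = Unique.tabulate⁺ inj₁-injective

  yLetters-unique : Unique yLetters
  yLetters-unique = Unique.tabulate⁺ inj₂-injective

  xLetters-yLetters-disjoint : ∀ {c} → c ∈ xLetters → c ∈ yLetters → ⊥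
  xLetters-yLetters-disjoint c∈xs c∈ys with ∈-tabulate⁻ c∈xs | ∈-tabulate⁻ c∈ys
  ... | _ , ≡.refl | _ , ()

  x≢y : ∀ {i j} → _≢_ {A = Letter m n} (inj₁ i) (inj₂ j)
  x≢y ()

  Mixed : Comm (Letter m n) → Set
  Mixed η = ∃₂ λ i j → LeftNormed (inj₁ i) (inj₂ j) η

  mixed-from-letters : ∀ {η} → (∃₂ λ a b → a ∈ xLetters × b ∈ yLetters × LeftNormed a b η) → Mixed η
  mixed-from-letters (_ , _ , a∈ , b∈ , s) with ∈-tabulate⁻ a∈ | ∈-tabulate⁻ b∈
  ... | i , ≡.refl | j , ≡.refl = i , j , s

  mixed-arguments : ∀ {η} → Mixed η → (∃[ i ] Occurs (inj₁ i) η) × (∃[ j ] Occurs (inj₂ j) η)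
  mixed-arguments (i , j , s) = (i , proj₁ (LeftNormed-occurs s)) , (j , proj₂ (LeftNormed-occurs s))

  mixed-components : ∀ {η} → Mixed η → ∀ (γ : Comm (Letter m n)) → Component γ η →
                     (∀ (i i′ : Fin m) → ¬ (γ ≡ com (xl i) (xl i′)))
                     × (∀ (j j′ : Fin n) → ¬ (γ ≡ com (yl j) (yl j′)))
  mixed-components (_ , _ , s) γ γ∈η with LeftNormed-component γ∈η s
  ... | inj₁ t = (λ { _ _ ≡.refl → x≢y (proj₂ (LeftNormed-pair t)) })
               , (λ { _ _ ≡.refl → x≢y (≡.sym (proj₁ (LeftNormed-pair t))) })
  ... | inj₂ (_ , ≡.refl) = (λ _ _ ()) , (λ _ _ ())

  mixed-weight : ∀ {η} → Mixed η → ¬ (∃[ i ] ∃[ i′ ] (η ≡ com (xl i) (yl i′))) → 2 < weight η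
  mixed-weight (i , j , s) notBasic with LeftNormed-weight s
  ... | inj₁ η≡xy = ⊥-elim (notBasic (i , j , η≡xy))
  ... | inj₂ heavy = heavy

lemmaB6 : ∀ {c ℓ : Level} (Γ : Group c ℓ) → IsNilpotent Γ →
    (m n : ℕ) → 1 ≤ m → 1 ≤ n →
    (x : Fin m → Group.Carrier Γ) → (y : Fin n → Group.Carrier Γ) →
    Σ (List (Comm (Letter m n))) λ ηs →
      Group._≈_ Γ (⟦_,_⟧ Γ (prodFin Γ m x) (prodFin Γ n y))
                  (prod Γ (map (eval Γ (subst-xy x y)) ηs))
      × (∀ (i : Fin m) (i′ : Fin n) → Any (λ η → η ≡ com (xl i) (yl i′)) ηs)
      × All (λ η → (∃[ i ] Occurs (inj₁ i) η) × (∃[ i′ ] Occurs (inj₂ i′) η)) ηs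
      × Unique ηs
      × All (λ η → ∀ (γ : Comm (Letter m n)) → Component γ η →
               (∀ (i i′ : Fin m) → ¬ (γ ≡ com (xl i) (xl i′)))
               × (∀ (j j′ : Fin n) → ¬ (γ ≡ com (yl j) (yl j′)))) ηs
      × All (λ η → ¬ (∃[ i ] ∃[ i′ ] (η ≡ com (xl i) (yl i′))) → 2 < weight η) ηs
lemmaB6 Γ _ m n _ _ x y =
  ηs , expansion , basic , All.map mixed-arguments mixed , distinct ,
  All.map mixed-components mixed , All.map mixed-weight mixed
  where
  open Group Γ using (_≈_; sym; trans; reflexive)
  open CommutatorIdentities Γ using (comm-cong)
  open Evaluation Γ (subst-xy x y)

  ηs : List (Comm (Letter m n))
  ηs = commWords xLetters yLetters

  expansion : ⟦_,_⟧ Γ (prodFin Γ m x) (prodFin Γ n y) ≈ value ηs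
  expansion = sym (trans (commWords-value xLetters yLetters)
    (comm-cong (reflexive (cong (prod Γ) (map-tabulate inj₁ (subst-xy x y))))
               (reflexive (cong (prod Γ) (map-tabulate inj₂ (subst-xy x y))))))

  basic : ∀ i i′ → Any (λ η → η ≡ com (xl i) (yl i′)) ηs
  basic i i′ = Any.map ≡.sym (commWords-∋ _ _ xLetters yLetters (∈-tabulate⁺ i) (∈-tabulate⁺ i′))

  mixed : All Mixed ηs
  mixed = All.map mixed-from-letters (commWords-shape xLetters yLetters)

  distinct : Unique ηs
  distinct = commWords-unique xLetters yLetters xLetters-unique yLetters-unique xLetters-yLetters-disjoint
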